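{- Let $G=(A\cup B,E)$ be a bipartite graph in which every node has a strict ranking of its neighbors, and let $G^*$ be the auxiliary instance defined below. If $S$ is a stable matching in $G^*$, then $S'$ is a popular max-matching in $G$.
   Context: Node $u$ prefers matching $M$ to $N$ if $u$ is matched in $M$ and unmatched in $N$, or matched in both and prefers its partner in $M$. $\phi(M,N)$ is the number of nodes preferring $M$ to $N$, $\Delta(M,N)=\phi(M,N)-\phi(N,M)$; a maximum matching $M$ of $G$ is a popular max-matching if $\Delta(M,N)\ge0$ for all maximum matchings $N$ of $G$. A matching $S$ in an instance with strict preferences is stable if no edge blocks it, where edge $(u,v)$ blocks $S$ if each of $u,v$ is unmatched in $S$ or prefers the other to its partner in $S$. The instance $G^*=(A^*\cup B^*,E^*)$: let $n_0=|A|$. $A^*=\{a_i: a\in A,\ 0\le i\le n_0-1\}$ ($n_0$ copies of each $a$). $B^*=\{\tilde b: b\in B\}\cup\{d_i(a): a\in A,\ 1\le i\le n_0-1\}$ (the $d_i(a)$ are dummy nodes). $E^*$ contains $(a_i,\tilde b)$ for every $(a,b)\in E$ and $0\le i\le n_0-1$, and $(a_{i-1},d_i(a))$, $(a_i,d_i(a))$ for every $a\in A$ and $1\le i\le n_0-1$. Preferences: if $a$'s ranking in $G$ is $b_1\succ\cdots\succ b_k$, then $a_0$ ranks $\tilde b_1\succ\cdots\succ\tilde b_k\succ d_1(a)$; for $1\le i\le n_0-2$, $a_i$ ranks $d_i(a)\succ\tilde b_1\succ\cdots\succ\tilde b_k\succ d_{i+1}(a)$; $a_{n_0-1}$ ranks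 $d_{n_0-1}(a)\succ\tilde b_1\succ\cdots\succ\tilde b_k$ (when $n_0=1$ there are no dummy nodes and $a_0$ ranks $\tilde b_1\succ\cdots\succ\tilde b_k$). Each $d_i(a)$ ranks $a_{i-1}\succ a_i$. Each $\tilde b$ ranks all its neighbors with subscript $n_0-1$ first, then all with subscript $n_0-2$, and so on, with all subscript-$0$ neighbors last; among neighbors with the same subscript $i$, $\tilde b$ prefers $z_i$ to $z'_i$ iff $b$ prefers $z$ to $z'$ in $G$. For a matching $S$ of $G^*$, $S'\subseteq E$ is obtained by deleting the edges of $S$ incident to dummy nodes and replacing each edge $(a_i,\tilde b)\in S$ by $(a,b)$. -}

module Defs where

open import Data.Nat using (ℕ; zero; suc; _+_; _∸_; _<_; _<ᵇ_; _≡ᵇ_)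
open import Data.Integer using (ℤ; +_; _-_; _≤_)
open import Data.Fin using (Fin; toℕ)
open import Data.Bool using (Bool; true; false; _∧_; _∨_; not; if_then_else_)
open import Data.List using (List; map; allFin)
open import Data.Nat.ListAction using (sum)
open import Data.Bool.ListAction using (any)
open import Data.Product using (_×_; _,_; Σ; ∃)
open import Data.Sum using (_⊎_; inj₁; inj₂)
open import Relation.Binary.PropositionalEquality using (_≡_)
open import Relation.Nullary using (¬_)

-- The instance G = (A ∪ B, E):  A = Fin nA, B = Fin nB.
-- Preferences are given by ranks (smaller rank = more preferred);
-- strictness: ranks are injective on the neighbours of every node.

record Instance : Set where
  field
    nA nB  : ℕ
    E      : Fin nA → Fin nB → Bool
    rankA  : Fin nA → Fin nB → ℕ
    rankB  : Fin nB → Fin nA → ℕ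
    strictA : ∀ a b b′ → E a b ≡ true → E a b′ ≡ true →
              rankA a b ≡ rankA a b′ → b ≡ b′
    strictB : ∀ b a a′ → E a b ≡ true → E a′ b ≡ true →
              rankB b a ≡ rankB b a′ → a ≡ a′

count : ∀ {n} → (Fin n → Bool) → ℕ
count {n} f = sum (map (λ x → if f x then 1 else 0) (allFin n))

module _ (G : Instance) where
  open Instance G

  Match : Set
  Match = Fin nA → Fin nB → Bool

  record IsMatching (M : Match) : Set where
    field
      ⊆E    : ∀ a b → M a b ≡ true → E a b ≡ true
      uniqA : ∀ a b b′ → M a b ≡ true → M a b′ ≡ true → b ≡ b′
      uniqB : ∀ a a′ b → M a b ≡ true → M a′ b ≡ true → a ≡ a′

  size : Match → ℕ
  size M = sum (map (λ a → count (M a)) (allFin nA))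

  IsMaximum : Match → Set
  IsMaximum M = IsMatching M × (∀ N → IsMatching N → size N Data.Nat.≤ size M)

  matchedA : Match → Fin nA → Bool
  matchedA M a = any (M a) (allFin nB)

  matchedB : Match → Fin nB → Bool
  matchedB M b = any (λ a → M a b) (allFin nA)

  prefersA : Match → Match → Fin nA → Bool
  prefersA M N a =
    (matchedA M a ∧ not (matchedA N a)) ∨
    any (λ b → any (λ b′ → M a b ∧ (N a b′ ∧ (rankA a b <ᵇ rankA a b′)))
                   (allFin nB)) (allFin nB)

  prefersB : Match → Match → Fin nB → Bool
  prefersB M N b =
    (matchedB M b ∧ not (matchedB N b)) ∨
    any (λ a → any (λ a′ → M a b ∧ (N a′ b ∧ (rankB b a <ᵇ rankB b a′)))
                   (allFin nA)) (allFin nA)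

  φ : Match → Match → ℕ
  φ M N = count (prefersA M N) + count (prefersB M N)

  Δ : Match → Match → ℤ
  Δ M N = + φ M N - + φ N M

  IsPopularMaxMatching : Match → Set
  IsPopularMaxMatching M =
    IsMaximum M × (∀ N → IsMaximum N → + 0 ≤ Δ M N)

-- A* = A × Fin n₀                 : (a , i) is a_i
--   B* = B ⊎ (A × Fin (n₀ ∸ 1))     : inj₁ b is b̃,
--                                     inj₂ (a , j) is the dummy d_{j+1}(a)

_<lex_ : ℕ × ℕ → ℕ × ℕ → Set
(x , y) <lex (x′ , y′) = x < x′ ⊎ (x ≡ x′ × y < y′)

module Star (G : Instance) where
  open Instance G

  n₀ : ℕ
  n₀ = nA

  A* : Set
  A* = Fin nA × Fin n₀

  B* : Set
  B* = Fin nB ⊎ (Fin nA × Fin (n₀ ∸ 1))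

  E* : A* → B* → Set
  E* (a , i) (inj₁ b)        = E a b ≡ true
  E* (a , i) (inj₂ (a′ , j)) = a ≡ a′ × (toℕ i ≡ toℕ j ⊎ toℕ i ≡ suc (toℕ j))

  -- a_i's ranking:  d_i(a) ≻ b̃_1 ≻ ... ≻ b̃_k ≻ d_{i+1}(a)
  -- (d_{j+1}(a) is d_{i+1}(a) iff j = i; otherwise it is d_i(a)).
  -- Only the relative order on neighbours matters.
  keyA : A* → B* → ℕ × ℕ
  keyA (a , i) (inj₁ b)        = (1 , rankA a b)
  keyA (a , i) (inj₂ (a′ , j)) = if toℕ j ≡ᵇ toℕ i then (2 , 0) else (0 , 0)

  prefA* : A* → B* → B* → Set
  prefA* x y y′ = keyA x y <lex keyA x y′

  prefB* : B* → A* → A* → Set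
  prefB* (inj₁ b) (a , i) (a′ , i′) =
    toℕ i′ < toℕ i ⊎ (toℕ i ≡ toℕ i′ × rankB b a < rankB b a′)
  prefB* (inj₂ d) (a , i) (a′ , i′) = toℕ i < toℕ i′

  Match* : Set
  Match* = A* → B* → Bool

  record IsMatching* (S : Match*) : Set where
    field
      ⊆E*   : ∀ x y → S x y ≡ true → E* x y
      uniqA : ∀ x y y′ → S x y ≡ true → S x y′ ≡ true → y ≡ y′
      uniqB : ∀ x x′ y → S x y ≡ true → S x′ y ≡ true → x ≡ x′

  WantsA : Match* → A* → B* → Set
  WantsA S x y = (∀ y′ → ¬ (S x y′ ≡ true)) ⊎
                 (Σ B* λ y′ → S x y′ ≡ true × prefA* x y y′)

  WantsB : Match* → B* → A* → Set
  WantsB S y x = (∀ x′ → ¬ (S x′ y ≡ true)) ⊎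
                 (Σ A* λ x′ → S x′ y ≡ true × prefB* y x x′)

  Blocks : Match* → A* → B* → Set
  Blocks S x y = E* x y × WantsA S x y × WantsB S y x

  IsStable : Match* → Set
  IsStable S = IsMatching* S × (∀ x y → ¬ Blocks S x y)

  -- S′: drop dummy edges, project (a_i , b̃) to (a , b)
  proj : Match* → Match G
  proj S a b = any (λ i → S (a , i) (inj₁ b)) (allFin n₀)

module Submission where

-- In a stable matching S of G* the copies a₀, …, a_{n₀-1} of a node a are chained through
-- the dummies: if some copy a_ℓ is matched to a real node then every copy below it sits on its last
-- choice d_{k+1}(a) and every copy above it on its first choice d_k(a), and if no copy is, then all
-- copies below a_{n₀-1} sit on their last choice and a_{n₀-1} is unmatched. So at most one copy of a
-- is matched to a real node, S′ is a matching, and a has a level ℓ(a) (ℓ above, or n₀-1); give b the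
-- level of the copy holding b̃. Stability says that whenever a copy a_k would rather have b̃, b̃ is held
-- by a copy of level at least k that b prefers to a on a tie. From this, every edge ab of a matching N
-- satisfies [a prefers N] + [b prefers N] + 2ℓ(a) ≤ [a prefers S′] + [b prefers S′] + 2ℓ(b). Summing
-- over N, and using that ∑_N ℓ(b) ≤ ∑_S′ ℓ(b) = ∑_S′ ℓ(a) ≤ ∑_N ℓ(a) when |N| = |S′| (nodes free in S′
-- have the maximal level n₀-1), gives popularity among maximum matchings. For maximality, pick a level
-- k held by no S′-matched node of A: the S′-matched a below k and the S′-matched b at or above k form
-- a vertex cover with one vertex per edge of S′.

open import Defs
open import Data.Nat using (ℕ; zero; suc; _+_; _*_; _∸_; _<_; _≤_; z≤n; s≤s; _<ᵇ_; _≡ᵇ_)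
open import Data.Nat.Properties
open import Data.Fin using (Fin; toℕ; fromℕ<; punchOut)
open import Data.Fin.Properties
  using (toℕ-injective; toℕ<n; toℕ-fromℕ<; any?; all?; ¬∀⟶∃¬; injective⇒≤; punchOut-injective)
import Data.Fin.Properties as Finₚ
open import Data.Bool using (Bool; true; false; not; _∧_; _∨_; if_then_else_)
open import Data.Bool.Properties using (T-≡; not-¬; ¬-not) renaming (_≟_ to _≟ᵇ_)
open import Data.List using (map; tabulate; allFin)
open import Data.List.Properties using (map-tabulate)
open import Data.List.Membership.Propositional.Properties using (∈-allFin)
import Data.List.Relation.Unary.Any as Any
open import Data.List.Relation.Unary.Any.Properties using (any⁺; any⁻)
import Data.Nat.ListAction as List
open import Data.Bool.ListAction using (any)
open import Data.Product using (∃; ∃-syntax; _×_; _,_; proj₁; proj₂)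
open import Data.Sum using (_⊎_; inj₁; inj₂)
open import Data.Empty using (⊥; ⊥-elim)
open import Function using (_∘_; id; Equivalence)
open import Relation.Binary.PropositionalEquality
open import Relation.Binary.Definitions using (tri<; tri≈; tri>)
open import Relation.Nullary using (¬_; Dec; yes; no; contradiction)
open import Relation.Nullary.Decidable using (map′; _⊎-dec_; _×-dec_)
open import Relation.Unary using (Decidable)
import Data.Integer as ℤ
open import Data.Integer.Properties using (i≤j⇒0≤j-i)
open import Algebra.Properties.CommutativeMonoid.Sum +-0-commutativeMonoid
  using (sum; sum-syntax; ∑-distrib-+; ∑-comm; sum-cong-≗)
open import Algebra.Properties.Semiring.Sum +-*-semiring using (*-distribˡ-sum)

open Equivalence using (to; from)

ind : Bool → ℕ
ind b = if b then 1 else 0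

ind≤1 : ∀ b → ind b ≤ 1
ind≤1 true  = ≤-refl
ind≤1 false = z≤n

<ᵇ-true : ∀ {m n} → m < n → (m <ᵇ n) ≡ true
<ᵇ-true m<n = to T-≡ (<⇒<ᵇ m<n)

<ᵇ-false : ∀ {m n} → n ≤ m → (m <ᵇ n) ≡ false
<ᵇ-false {m} {n} n≤m with m <ᵇ n in e
... | false = refl
... | true  = contradiction (<ᵇ⇒< m n (from T-≡ e)) (≤⇒≯ n≤m)

≡ᵇ-true : ∀ {m n} → m ≡ n → (m ≡ᵇ n) ≡ true
≡ᵇ-true {m} {n} m≡n = to T-≡ (≡⇒≡ᵇ m n m≡n)

≡ᵇ-false : ∀ {m n} → m ≢ n → (m ≡ᵇ n) ≡ false
≡ᵇ-false {m} {n} m≢n with m ≡ᵇ n in e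
... | false = refl
... | true  = contradiction (≡ᵇ⇒≡ m n (from T-≡ e)) m≢n

module _ {n : ℕ} (p : Fin n → Bool) where

  any-allFin⁺ : ∀ x → p x ≡ true → any p (allFin n) ≡ true
  any-allFin⁺ x px = to T-≡ (any⁺ p (Any.map (λ { refl → from T-≡ px }) (∈-allFin x)))

  any-allFin⁻ : any p (allFin n) ≡ true → ∃[ x ] p x ≡ true
  any-allFin⁻ e with Any.satisfied (any⁻ p (allFin n) (from T-≡ e))
  ... | x , px = x , to T-≡ px

  any-allFin-false⁺ : (∀ x → p x ≡ false) → any p (allFin n) ≡ false
  any-allFin-false⁺ none with any p (allFin n) in e
  ... | false = refl
  ... | true  = let (x , px) = any-allFin⁻ e in contradiction (none x) (not-¬ px)

  any-allFin-false⁻ : any p (allFin n) ≡ false → ∀ x → p x ≡ false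
  any-allFin-false⁻ e x with p x in px
  ... | false = refl
  ... | true  = contradiction e (not-¬ (any-allFin⁺ x px))

AtMostOne : ∀ {n} → (Fin n → Bool) → Set
AtMostOne p = ∀ x y → p x ≡ true → p y ≡ true → x ≡ y

Exhaustible : Set → Set₁
Exhaustible X = ∀ {P : X → Set} → Decidable P → Dec (∃ P)

×-exhaustible : ∀ {X Y} → Exhaustible X → Exhaustible Y → Exhaustible (X × Y)
×-exhaustible ∃X? ∃Y? P? =
  map′ (λ (x , y , p) → (x , y) , p) (λ ((x , y) , p) → x , y , p)
       (∃X? λ x → ∃Y? λ y → P? (x , y))

⊎-exhaustible : ∀ {X Y} → Exhaustible X → Exhaustible Y → Exhaustible (X ⊎ Y)
⊎-exhaustible ∃X? ∃Y? P? =
  map′ (λ { (inj₁ (x , p)) → inj₁ x , p ; (inj₂ (y , p)) → inj₂ y , p })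
       (λ { (inj₁ x , p) → inj₁ (x , p) ; (inj₂ y , p) → inj₂ (y , p) })
       (∃X? (P? ∘ inj₁) ⊎-dec ∃Y? (P? ∘ inj₂))

-- Pigeonhole: if a₀ ∉ P, fewer than n elements satisfy P, so ℓ misses some value below n on P.
attained? : ∀ {n} {P : Fin n → Set} → Decidable P → (ℓ : Fin n → ℕ) →
            Decidable (λ (k : Fin n) → ∃[ a ] P a × ℓ a ≡ toℕ k)
attained? P? ℓ k = any? (λ a → P? a ×-dec (ℓ a ≟ toℕ k))

missed-value : ∀ {n} {P : Fin n → Set} → Decidable P → (ℓ : Fin n → ℕ) → ∀ a₀ → ¬ P a₀ →
               ∃ λ (k : Fin n) → ∀ a → P a → ℓ a ≢ toℕ k
missed-value {suc m} {P} P? ℓ a₀ ¬Pa₀ with all? (attained? P? ℓ)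
... | no ¬allHit = let (k , ¬hit) = ¬∀⟶∃¬ _ _ (attained? P? ℓ) ¬allHit in k , λ a Pa e → ¬hit (a , Pa , e)
... | yes allHit = contradiction (injective⇒≤ squeeze-injective) 1+n≰n
  where
  g : Fin (suc m) → Fin (suc m)
  g k = proj₁ (allHit k)

  a₀≢g : ∀ k → a₀ ≢ g k
  a₀≢g k a₀≡gk = ¬Pa₀ (subst P (sym a₀≡gk) (proj₁ (proj₂ (allHit k))))

  squeeze : Fin (suc m) → Fin m
  squeeze k = punchOut (a₀≢g k)

  squeeze-injective : ∀ {i j} → squeeze i ≡ squeeze j → i ≡ j
  squeeze-injective {i} {j} e = toℕ-injective (begin
    toℕ i     ≡⟨ sym (proj₂ (proj₂ (allHit i))) ⟩
    ℓ (g i)   ≡⟨ cong ℓ (punchOut-injective (a₀≢g i) (a₀≢g j) e) ⟩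
    ℓ (g j)   ≡⟨ proj₂ (proj₂ (allHit j)) ⟩
    toℕ j     ∎)
    where open ≡-Reasoning

∑-allFin : ∀ {n} (f : Fin n → ℕ) → List.sum (map f (allFin n)) ≡ ∑[ i < n ] f i
∑-allFin f = trans (cong List.sum (map-tabulate id f)) (sum-tabulate f)
  where
  sum-tabulate : ∀ {n} (f : Fin n → ℕ) → List.sum (tabulate f) ≡ ∑[ i < n ] f i
  sum-tabulate {zero}  f = refl
  sum-tabulate {suc n} f = cong (f Fin.zero +_) (sum-tabulate (f ∘ Fin.suc))

∑-mono-≤ : ∀ {n} {f g : Fin n → ℕ} → (∀ i → f i ≤ g i) → ∑[ i < n ] f i ≤ ∑[ i < n ] g i
∑-mono-≤ {zero}  f≤g = z≤n
∑-mono-≤ {suc n} f≤g = +-mono-≤ (f≤g Fin.zero) (∑-mono-≤ (f≤g ∘ Fin.suc))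

∑-zero : ∀ {n} (f : Fin n → ℕ) → (∀ i → f i ≡ 0) → ∑[ i < n ] f i ≡ 0
∑-zero {zero}  f f≡0 = refl
∑-zero {suc n} f f≡0 rewrite f≡0 Fin.zero = ∑-zero (f ∘ Fin.suc) (f≡0 ∘ Fin.suc)

∑-single : ∀ {n} (p : Fin n → Bool) c x → p x ≡ true → AtMostOne p →
           ∑[ i < n ] (if p i then c else 0) ≡ c
∑-single p c Fin.zero px one rewrite px =
  trans (cong (c +_) (∑-zero _ rest)) (+-identityʳ c)
  where
  rest : ∀ i → (if p (Fin.suc i) then c else 0) ≡ 0
  rest i with p (Fin.suc i) in pi
  ... | false = refl
  ... | true  with one _ _ pi px
  ...   | ()
∑-single p c (Fin.suc x) px one with p Fin.zero in p0
... | true  with one _ _ p0 px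
...   | ()
∑-single p c (Fin.suc x) px one | false =
  ∑-single (p ∘ Fin.suc) c x px (λ y z py pz → Finₚ.suc-injective (one _ _ py pz))

∑-indicator : ∀ {n} (p : Fin n → Bool) c → AtMostOne p →
              ∑[ i < n ] (if p i then c else 0) ≡ (if any p (allFin n) then c else 0)
∑-indicator {n} p c one with any p (allFin n) in e
... | true  = let (x , px) = any-allFin⁻ p e in ∑-single p c x px one
... | false = ∑-zero _ λ i → cong (λ b → if b then c else 0) (any-allFin-false⁻ p e i)

∑-restrict : ∀ {n} (m : Fin n → Bool) (g : Fin n → ℕ) → (∀ i → m i ≡ false → g i ≡ 0) →
             ∑[ i < n ] (if m i then g i else 0) ≡ ∑[ i < n ] g i
∑-restrict m g vanish = sum-cong-≗ λ i → restrict i (m i) refl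
  where
  restrict : ∀ i b → m i ≡ b → (if b then g i else 0) ≡ g i
  restrict i true  _  = refl
  restrict i false mi = sym (vanish i mi)

∑-restrict-≤ : ∀ {n} (m : Fin n → Bool) (g : Fin n → ℕ) →
               ∑[ i < n ] (if m i then g i else 0) ≤ ∑[ i < n ] g i
∑-restrict-≤ m g = ∑-mono-≤ λ i → restrict (m i)
  where
  restrict : ∀ b {x} → (if b then x else 0) ≤ x
  restrict true  = ≤-refl
  restrict false = z≤n

balance-free : ∀ {p} q m → p ≤ 1 → p + 0 + m ≤ q + 1 + m
balance-free {p} q m p≤1 =
  +-monoˡ-≤ m (≤-trans (≤-reflexive (+-identityʳ p)) (≤-trans p≤1 (m≤n+m 1 q)))

balance-upgrade : ∀ {p} q {c ℓ} → p ≤ 1 → c < ℓ → 1 + p + 2 * c ≤ q + 2 * ℓ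
balance-upgrade {p} q {c} {ℓ} p≤1 c<ℓ = begin
  1 + p + 2 * c ≤⟨ +-monoˡ-≤ (2 * c) (s≤s p≤1) ⟩
  2 + 2 * c     ≡⟨ sym (*-suc 2 c) ⟩
  2 * suc c     ≤⟨ *-monoʳ-≤ 2 c<ℓ ⟩
  2 * ℓ         ≤⟨ m≤n+m (2 * ℓ) q ⟩
  q + 2 * ℓ     ∎
  where open ≤-Reasoning

balance-downgrade : ∀ {p} q {ℓ ℓ′} → p ≤ 1 → ℓ ≤ ℓ′ → p + 2 * ℓ ≤ 1 + q + 2 * ℓ′
balance-downgrade q p≤1 ℓ≤ℓ′ = +-mono-≤ (≤-trans p≤1 (m≤m+n 1 q)) (*-monoʳ-≤ 2 ℓ≤ℓ′)

-- prefersA G M N a and prefersB G M N b unfold to Prefers applied to the row of a, resp. the column of b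

Prefers : ∀ {k} → (Fin k → Bool) → (Fin k → Bool) → (Fin k → ℕ) → Bool
Prefers {k} m n r =
  (any m (allFin k) ∧ not (any n (allFin k))) ∨
  any (λ x → any (λ x′ → m x ∧ (n x′ ∧ (r x <ᵇ r x′))) (allFin k)) (allFin k)

module _ {k : ℕ} (m n : Fin k → Bool) (r : Fin k → ℕ) where

  prefers-matched : ∀ {x y} → AtMostOne m → AtMostOne n → m x ≡ true → n y ≡ true →
                    Prefers m n r ≡ (r x <ᵇ r y)
  prefers-matched {x} {y} one-m one-n mx ny
    rewrite any-allFin⁺ m x mx | any-allFin⁺ n y ny with r x <ᵇ r y in x≺y
  ... | true  = any-allFin⁺ _ x (any-allFin⁺ _ y (subst₂ (λ u v → (u ∧ (v ∧ _)) ≡ true) (sym mx) (sym ny) x≺y))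
  ... | false = any-allFin-false⁺ _ λ x₁ → any-allFin-false⁺ _ λ y₁ → no-witness x₁ y₁
    where
    no-witness : ∀ x₁ y₁ → (m x₁ ∧ (n y₁ ∧ (r x₁ <ᵇ r y₁))) ≡ false
    no-witness x₁ y₁ with m x₁ in mx₁ | n y₁ in ny₁
    ... | false | _     = refl
    ... | true  | false = refl
    ... | true  | true  with one-m _ _ mx₁ mx | one-n _ _ ny₁ ny
    ...   | refl | refl = x≺y

  prefers-unmatched : (∀ x → m x ≡ false) → Prefers m n r ≡ false
  prefers-unmatched none rewrite any-allFin-false⁺ m none =
    any-allFin-false⁺ _ λ x → any-allFin-false⁺ _ λ y → cong (_∧ (n y ∧ (r x <ᵇ r y))) (none x)

module _ (G : Instance) where
  open Instance G

  _↾_ : Match G → (Fin nA → Fin nB → ℕ) → Fin nA → Fin nB → ℕ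
  (M ↾ F) a b = if M a b then F a b else 0

  edgeSum : Match G → (Fin nA → Fin nB → ℕ) → ℕ
  edgeSum M F = ∑[ a < nA ] ∑[ b < nB ] (M ↾ F) a b

  module _ (M : Match G) where

    edgeSum-mono : ∀ {F H} → (∀ a b → M a b ≡ true → F a b ≤ H a b) → edgeSum M F ≤ edgeSum M H
    edgeSum-mono {F} {H} F≤H = ∑-mono-≤ λ a → ∑-mono-≤ λ b → on-edge a b (M a b) refl
      where
      on-edge : ∀ a b t → M a b ≡ t → (if t then F a b else 0) ≤ (if t then H a b else 0)
      on-edge a b true  e = F≤H a b e
      on-edge a b false _ = z≤n

    edgeSum-cong : ∀ {F H} → (∀ a b → M a b ≡ true → F a b ≡ H a b) → edgeSum M F ≡ edgeSum M H
    edgeSum-cong F≡H = ≤-antisym (edgeSum-mono λ a b e → ≤-reflexive (F≡H a b e))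
                                 (edgeSum-mono λ a b e → ≤-reflexive (sym (F≡H a b e)))

    edgeSum-+ : ∀ F H → edgeSum M (λ a b → F a b + H a b) ≡ edgeSum M F + edgeSum M H
    edgeSum-+ F H =
      trans (sum-cong-≗ λ a → trans (sum-cong-≗ λ b → if-+ (M a b) (F a b) (H a b))
                                    (∑-distrib-+ ((M ↾ F) a) ((M ↾ H) a)))
            (∑-distrib-+ (λ a → ∑[ b < nB ] (M ↾ F) a b) (λ a → ∑[ b < nB ] (M ↾ H) a b))
      where
      if-+ : ∀ t x y → (if t then x + y else 0) ≡ (if t then x else 0) + (if t then y else 0)
      if-+ true  _ _ = refl
      if-+ false _ _ = refl

    edgeSum-* : ∀ c F → edgeSum M (λ a b → c * F a b) ≡ c * edgeSum M F
    edgeSum-* c F =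
      trans (sum-cong-≗ λ a → trans (sum-cong-≗ λ b → if-* (M a b) (F a b))
                                    (sym (*-distribˡ-sum c ((M ↾ F) a))))
            (sym (*-distribˡ-sum c (λ a → ∑[ b < nB ] (M ↾ F) a b)))
      where
      if-* : ∀ t x → (if t then c * x else 0) ≡ c * (if t then x else 0)
      if-* true  _ = refl
      if-* false _ = sym (*-zeroʳ c)

    size≡edgeSum : size G M ≡ edgeSum M (λ _ _ → 1)
    size≡edgeSum = trans (∑-allFin (λ a → count (M a))) (sum-cong-≗ λ a → ∑-allFin (ind ∘ M a))

    module _ (M-matching : IsMatching G M) where

      edgeSum-rows : ∀ (g : Fin nA → ℕ) →
                     edgeSum M (λ a _ → g a) ≡ ∑[ a < nA ] (if matchedA G M a then g a else 0)
      edgeSum-rows g = sum-cong-≗ λ a → ∑-indicator (M a) (g a) (IsMatching.uniqA M-matching a)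

      edgeSum-columns : ∀ (h : Fin nB → ℕ) →
                        edgeSum M (λ _ b → h b) ≡ ∑[ b < nB ] (if matchedB G M b then h b else 0)
      edgeSum-columns h = trans (∑-comm (M ↾ λ _ b → h b)) (sum-cong-≗ λ b →
        ∑-indicator (λ a → M a b) (h b) (λ a a′ → IsMatching.uniqB M-matching a a′ b))

      size≤cover : ∀ (wA : Fin nA → ℕ) (wB : Fin nB → ℕ) → (∀ a b → M a b ≡ true → 1 ≤ wA a + wB b) →
                   size G M ≤ ∑[ a < nA ] wA a + ∑[ b < nB ] wB b
      size≤cover wA wB covered = begin
        size G M                                            ≡⟨ size≡edgeSum ⟩
        edgeSum M (λ _ _ → 1)                               ≤⟨ edgeSum-mono covered ⟩
        edgeSum M (λ a b → wA a + wB b)                     ≡⟨ edgeSum-+ _ _ ⟩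
        edgeSum M (λ a _ → wA a) + edgeSum M (λ _ b → wB b) ≡⟨ cong₂ _+_ (edgeSum-rows wA) (edgeSum-columns wB) ⟩
        ∑[ a < nA ] (if matchedA G M a then wA a else 0) +
        ∑[ b < nB ] (if matchedB G M b then wB b else 0)    ≤⟨ +-mono-≤ (∑-restrict-≤ _ wA) (∑-restrict-≤ _ wB) ⟩
        ∑[ a < nA ] wA a + ∑[ b < nB ] wB b                 ∎
        where open ≤-Reasoning

      size≡cover : ∀ (wA : Fin nA → ℕ) (wB : Fin nB → ℕ) → (∀ a b → M a b ≡ true → wA a + wB b ≡ 1) →
                   (∀ a → matchedA G M a ≡ false → wA a ≡ 0) → (∀ b → matchedB G M b ≡ false → wB b ≡ 0) →
                   size G M ≡ ∑[ a < nA ] wA a + ∑[ b < nB ] wB b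
      size≡cover wA wB tight vanishA vanishB = begin
        size G M                                            ≡⟨ size≡edgeSum ⟩
        edgeSum M (λ _ _ → 1)                               ≡⟨ edgeSum-cong (λ a b e → sym (tight a b e)) ⟩
        edgeSum M (λ a b → wA a + wB b)                     ≡⟨ edgeSum-+ _ _ ⟩
        edgeSum M (λ a _ → wA a) + edgeSum M (λ _ b → wB b) ≡⟨ cong₂ _+_ (edgeSum-rows wA) (edgeSum-columns wB) ⟩
        ∑[ a < nA ] (if matchedA G M a then wA a else 0) +
        ∑[ b < nB ] (if matchedB G M b then wB b else 0)    ≡⟨ cong₂ _+_ (∑-restrict _ wA vanishA) (∑-restrict _ wB vanishB) ⟩
        ∑[ a < nA ] wA a + ∑[ b < nB ] wB b                 ∎
        where open ≡-Reasoning

      count-prefersA : ∀ M′ → count (prefersA G M M′) ≡ edgeSum M (λ a _ → ind (prefersA G M M′ a))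
      count-prefersA M′ = trans (∑-allFin (ind ∘ prefersA G M M′)) (trans
        (sym (∑-restrict (matchedA G M) _ λ a unmatched →
          cong ind (prefers-unmatched (M a) (M′ a) (rankA a) (any-allFin-false⁻ (M a) unmatched))))
        (sym (edgeSum-rows _)))

      count-prefersB : ∀ M′ → count (prefersB G M M′) ≡ edgeSum M (λ _ b → ind (prefersB G M M′ b))
      count-prefersB M′ = trans (∑-allFin (ind ∘ prefersB G M M′)) (trans
        (sym (∑-restrict (matchedB G M) _ λ b unmatched →
          cong ind (prefers-unmatched (λ a → M a b) (λ a → M′ a b) (rankB b)
                                      (any-allFin-false⁻ (λ a → M a b) unmatched))))
        (sym (edgeSum-columns _)))

      edgeSum≤countA : ∀ (f : Fin nA → Bool) → edgeSum M (λ a _ → ind (f a)) ≤ count f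
      edgeSum≤countA f = begin
        edgeSum M (λ a _ → ind (f a))                           ≡⟨ edgeSum-rows _ ⟩
        ∑[ a < nA ] (if matchedA G M a then ind (f a) else 0)   ≤⟨ ∑-restrict-≤ (matchedA G M) (ind ∘ f) ⟩
        ∑[ a < nA ] ind (f a)                                   ≡⟨ sym (∑-allFin (ind ∘ f)) ⟩
        count f                                                 ∎
        where open ≤-Reasoning

      edgeSum≤countB : ∀ (f : Fin nB → Bool) → edgeSum M (λ _ b → ind (f b)) ≤ count f
      edgeSum≤countB f = begin
        edgeSum M (λ _ b → ind (f b))                           ≡⟨ edgeSum-columns _ ⟩
        ∑[ b < nB ] (if matchedB G M b then ind (f b) else 0)   ≤⟨ ∑-restrict-≤ (matchedB G M) (ind ∘ f) ⟩
        ∑[ b < nB ] ind (f b)                                   ≡⟨ sym (∑-allFin (ind ∘ f)) ⟩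
        count f                                                 ∎
        where open ≤-Reasoning

  rowSum-≤ : ∀ {M N} → IsMatching G M → IsMatching G N → size G M ≡ size G N →
             (ℓ : Fin nA → ℕ) (K : ℕ) → (∀ a → ℓ a ≤ K) → (∀ a → matchedA G M a ≡ false → ℓ a ≡ K) →
             edgeSum M (λ a _ → ℓ a) ≤ edgeSum N (λ a _ → ℓ a)
  rowSum-≤ {M} {N} M-matching N-matching |M|≡|N| ℓ K ℓ≤K full =
    +-cancelʳ-≤ (slack M) (edgeSum M ℓ′) (edgeSum N ℓ′) (begin
      edgeSum M ℓ′ + slack M ≡⟨ total M ⟩
      K * size G M           ≡⟨ cong (K *_) |M|≡|N| ⟩
      K * size G N           ≡⟨ sym (total N) ⟩
      edgeSum N ℓ′ + slack N ≤⟨ +-monoʳ-≤ (edgeSum N ℓ′) slackN≤slackM ⟩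
      edgeSum N ℓ′ + slack M ∎)
    where
    open ≤-Reasoning
    ℓ′ : Fin nA → Fin nB → ℕ
    ℓ′ a _ = ℓ a

    slack : Match G → ℕ
    slack L = edgeSum L (λ a _ → K ∸ ℓ a)

    total : ∀ L → edgeSum L ℓ′ + slack L ≡ K * size G L
    total L = begin-equality
      edgeSum L ℓ′ + slack L              ≡⟨ sym (edgeSum-+ L _ _) ⟩
      edgeSum L (λ a _ → ℓ a + (K ∸ ℓ a)) ≡⟨ edgeSum-cong L (λ a _ _ → trans (m+[n∸m]≡n (ℓ≤K a)) (sym (*-identityʳ K))) ⟩
      edgeSum L (λ _ _ → K * 1)           ≡⟨ edgeSum-* L K _ ⟩
      K * edgeSum L (λ _ _ → 1)           ≡⟨ cong (K *_) (sym (size≡edgeSum L)) ⟩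
      K * size G L                        ∎

    slackN≤slackM : slack N ≤ slack M
    slackN≤slackM = begin
      slack N                                                ≡⟨ edgeSum-rows N N-matching _ ⟩
      ∑[ a < nA ] (if matchedA G N a then K ∸ ℓ a else 0)    ≤⟨ ∑-restrict-≤ (matchedA G N) (λ a → K ∸ ℓ a) ⟩
      ∑[ a < nA ] (K ∸ ℓ a)                                  ≡⟨ sym (∑-restrict _ _ λ a unmatched →
                                                               trans (cong (K ∸_) (full a unmatched)) (n∸n≡0 K)) ⟩
      ∑[ a < nA ] (if matchedA G M a then K ∸ ℓ a else 0)    ≡⟨ sym (edgeSum-rows M M-matching _) ⟩
      slack M                                                ∎

-- The structure of a stable matching of G*

module StableMatching (G : Instance) (S : Star.Match* G) (stable : Star.IsStable G S) where
  open Instance G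
  open Star G
  open IsMatching* (proj₁ stable)

  unblocked : ∀ x y → ¬ Blocks S x y
  unblocked = proj₂ stable

  -- index of the top copy a_{n₀-1}
  K : ℕ
  K = nA ∸ 1

  K<nA : Fin nA → K < nA
  K<nA = pred<
    where
    pred< : ∀ {n} → Fin n → n ∸ 1 < n
    pred< {suc n} _ = n<1+n n

  toℕ≤K : ∀ (c : Fin nA) → toℕ c ≤ K
  toℕ≤K c = ∸-monoˡ-≤ 1 (toℕ<n c)

  Unmatched : A* → Set
  Unmatched x = ∀ y → S x y ≢ true

  prefers⇒wants : ∀ x y → (∀ y′ → S x y′ ≡ true → prefA* x y y′) → WantsA S x y
  prefers⇒wants x y better with ⊎-exhaustible any? (×-exhaustible any? any?) (λ y′ → S x y′ ≟ᵇ true)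
  ... | yes (y′ , s) = inj₂ (y′ , s , better y′ s)
  ... | no unmatched = inj₁ λ y′ s → unmatched (y′ , s)

  module _ {a c a′ : Fin nA} {j : Fin K} where

    prefers-firstDummy-to-real : ∀ {b} → suc (toℕ j) ≡ toℕ c → prefA* (a , c) (inj₂ (a′ , j)) (inj₁ b)
    prefers-firstDummy-to-real j<c rewrite ≡ᵇ-false (λ j≡c → 1+n≢n (trans j<c (sym j≡c))) = inj₁ (s≤s z≤n)

    prefers-firstDummy-to-lastDummy : ∀ {a″} {j′ : Fin K} → suc (toℕ j) ≡ toℕ c → toℕ j′ ≡ toℕ c →
                                      prefA* (a , c) (inj₂ (a′ , j)) (inj₂ (a″ , j′))
    prefers-firstDummy-to-lastDummy j<c j′≡c
      rewrite ≡ᵇ-false (λ j≡c → 1+n≢n (trans j<c (sym j≡c))) | ≡ᵇ-true j′≡c = inj₁ (s≤s z≤n)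

    prefers-real-to-lastDummy : ∀ {b} → toℕ j ≡ toℕ c → prefA* (a , c) (inj₁ b) (inj₂ (a′ , j))
    prefers-real-to-lastDummy j≡c rewrite ≡ᵇ-true j≡c = inj₁ ≤-refl

  -- inj₂ (a , j) is d_{j+1}(a), so these say that a_k is matched to d_k(a), to d_{k+1}(a), or to some b̃
  OnFirstDummy OnLastDummy OnReal : Fin nA → ℕ → Set
  OnFirstDummy a k = ∃[ c ] ∃[ j ] toℕ c ≡ k × suc (toℕ j) ≡ k × S (a , c) (inj₂ (a , j)) ≡ true
  OnLastDummy  a k = ∃[ c ] ∃[ j ] toℕ c ≡ k × toℕ j ≡ k × S (a , c) (inj₂ (a , j)) ≡ true
  OnReal       a k = ∃[ c ] ∃[ b ] toℕ c ≡ k × S (a , c) (inj₁ b) ≡ true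

  copy-partner-unique : ∀ {a c c′ y y′} → toℕ c ≡ toℕ c′ → S (a , c) y ≡ true → S (a , c′) y′ ≡ true → y ≡ y′
  copy-partner-unique c≡c′ s s′ with toℕ-injective c≡c′
  ... | refl = uniqA _ _ _ s s′

  dummy-partner-unique : ∀ {x x′ a} {j j′ : Fin K} → toℕ j ≡ toℕ j′ →
                         S x (inj₂ (a , j)) ≡ true → S x′ (inj₂ (a , j′)) ≡ true → x ≡ x′
  dummy-partner-unique j≡j′ s s′ with toℕ-injective j≡j′
  ... | refl = uniqB _ _ _ s s′

  firstDummy-lastDummy-exclusive : ∀ {a k} → OnFirstDummy a k → OnLastDummy a k → ⊥
  firstDummy-lastDummy-exclusive (c , j , c≡k , j<k , s) (c′ , j′ , c′≡k , j′≡k , s′)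
    with copy-partner-unique (trans c≡k (sym c′≡k)) s s′
  ... | refl = 1+n≢n (trans j<k (sym j′≡k))

  firstDummy-real-exclusive : ∀ {a k} → OnFirstDummy a k → OnReal a k → ⊥
  firstDummy-real-exclusive (c , _ , c≡k , _ , s) (c′ , _ , c′≡k , s′)
    with copy-partner-unique (trans c≡k (sym c′≡k)) s s′
  ... | ()

  lastDummy-real-exclusive : ∀ {a k} → OnLastDummy a k → OnReal a k → ⊥
  lastDummy-real-exclusive (c , _ , c≡k , _ , s) (c′ , _ , c′≡k , s′)
    with copy-partner-unique (trans c≡k (sym c′≡k)) s s′
  ... | ()

  -- d_{k+1}(a) is a_{k+1}'s first choice, so if it were free it would block with a_{k+1}.
  module _ (a : Fin nA) {k : ℕ} (k+1<nA : suc k < nA) where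

    private
      k<nA : k < nA
      k<nA = <-trans (n<1+n k) k+1<nA

      j : Fin K
      j = fromℕ< (∸-monoˡ-< k+1<nA (s≤s z≤n))

      j≡k : toℕ j ≡ k
      j≡k = toℕ-fromℕ< _

      aₖ aₖ₊₁ : A*
      aₖ   = a , fromℕ< k<nA
      aₖ₊₁ = a , fromℕ< k+1<nA

      dₖ₊₁ : B*
      dₖ₊₁ = inj₂ (a , j)

    dummy-taken : OnLastDummy a k ⊎ OnFirstDummy a (suc k)
    dummy-taken with S aₖ dₖ₊₁ in sₖ | S aₖ₊₁ dₖ₊₁ in sₖ₊₁
    ... | true  | _     = inj₁ (_ , j , toℕ-fromℕ< k<nA , j≡k , sₖ)
    ... | false | true  = inj₂ (_ , j , toℕ-fromℕ< k+1<nA , cong suc j≡k , sₖ₊₁)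
    ... | false | false = ⊥-elim (unblocked aₖ₊₁ dₖ₊₁ (edge , aₖ₊₁-wants , inj₁ dₖ₊₁-free))
      where
      j<k+1 : suc (toℕ j) ≡ toℕ (proj₂ aₖ₊₁)
      j<k+1 = trans (cong suc j≡k) (sym (toℕ-fromℕ< k+1<nA))

      edge : E* aₖ₊₁ dₖ₊₁
      edge = refl , inj₂ (sym j<k+1)

      dₖ₊₁-free : ∀ x → S x dₖ₊₁ ≢ true
      dₖ₊₁-free (_ , c) s with ⊆E* _ _ s
      ... | refl , inj₁ c≡j with toℕ-injective (trans c≡j (trans j≡k (sym (toℕ-fromℕ< k<nA))))
      ...   | refl = not-¬ s sₖ
      dₖ₊₁-free (_ , c) s | refl , inj₂ c≡j+1 with toℕ-injective (trans c≡j+1 j<k+1)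
      ...   | refl = not-¬ s sₖ₊₁

      aₖ₊₁-wants : WantsA S aₖ₊₁ dₖ₊₁
      aₖ₊₁-wants = prefers⇒wants aₖ₊₁ dₖ₊₁ better
        where
        better : ∀ y′ → S aₖ₊₁ y′ ≡ true → prefA* aₖ₊₁ dₖ₊₁ y′
        better (inj₁ b) _ = prefers-firstDummy-to-real {a′ = a} j<k+1
        better (inj₂ (_ , j′)) s with ⊆E* _ _ s
        ... | refl , inj₁ c≡j′ = prefers-firstDummy-to-lastDummy {a = a} {a′ = a} {a″ = a} j<k+1 (sym c≡j′)
        ... | refl , inj₂ c≡j′+1 with toℕ-injective {i = j′} {j = j} (suc-injective (trans (sym c≡j′+1) (sym j<k+1)))
        ...   | refl = contradiction sₖ₊₁ (not-¬ s)

  onFirstDummy-above-real : ∀ {a c b k} → S (a , c) (inj₁ b) ≡ true → toℕ c < k → k < nA → OnFirstDummy a k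
  onFirstDummy-above-real {a} {k = suc k} s (s≤s c≤k) k+1<nA with dummy-taken a k+1<nA
  ... | inj₂ first = first
  ... | inj₁ last with m≤n⇒m<n∨m≡n c≤k
  ...   | inj₁ c<k = ⊥-elim (firstDummy-lastDummy-exclusive
                               (onFirstDummy-above-real s c<k (<-trans (n<1+n k) k+1<nA)) last)
  ...   | inj₂ refl = ⊥-elim (lastDummy-real-exclusive last (_ , _ , refl , s))

  real-copy-unique : ∀ {a c c′ b b′} → S (a , c) (inj₁ b) ≡ true → S (a , c′) (inj₁ b′) ≡ true → c ≡ c′
  real-copy-unique {c = c} {c′} s s′ with <-cmp (toℕ c) (toℕ c′)
  ... | tri≈ _ c≡c′ _ = toℕ-injective c≡c′
  ... | tri< c<c′ _ _ = ⊥-elim (firstDummy-real-exclusive (onFirstDummy-above-real s c<c′ (toℕ<n c′)) (_ , _ , refl , s′))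
  ... | tri> _ _ c′<c = ⊥-elim (firstDummy-real-exclusive (onFirstDummy-above-real s′ c′<c (toℕ<n c)) (_ , _ , refl , s))

  Free : Fin nA → Set
  Free a = ∀ c b → S (a , c) (inj₁ b) ≢ true

  copy-unmatched : ∀ {a c} → Free a →
                   (∀ {j} → toℕ j ≡ toℕ c → S (a , c) (inj₂ (a , j)) ≢ true) →
                   (∀ {j} → suc (toℕ j) ≡ toℕ c → S (a , c) (inj₂ (a , j)) ≢ true) →
                   Unmatched (a , c)
  copy-unmatched free _ _ (inj₁ b) = free _ b
  copy-unmatched free notLast notFirst (inj₂ (_ , j)) s with ⊆E* _ _ s
  ... | refl , inj₁ c≡j   = notLast (sym c≡j) s
  ... | refl , inj₂ c≡j+1 = notFirst (sym c≡j+1) s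

  lastDummy⇒next-notFirst : ∀ {a k c} {j : Fin K} → OnLastDummy a k → toℕ c ≡ suc k → suc (toℕ j) ≡ suc k →
                            S (a , c) (inj₂ (a , j)) ≢ true
  lastDummy⇒next-notFirst (c′ , j′ , c′≡k , j′≡k , s′) c≡k+1 j<k+1 s
    with dummy-partner-unique (trans (suc-injective j<k+1) (sym j′≡k)) s s′
  ... | refl = 1+n≢n (trans (sym c≡k+1) c′≡k)

  -- if a is free and d_k(a) is not taken by a_k, then a_k is on d_{k+1}(a): otherwise a_k would be
  -- unmatched and would block with d_{k+1}(a), which prefers a_k to a_{k+1}
  free⇒onLastDummy-step : ∀ {a k} → Free a → (∀ {c} {j : Fin K} → toℕ c ≡ k → suc (toℕ j) ≡ k → S (a , c) (inj₂ (a , j)) ≢ true) →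
              suc k < nA → OnLastDummy a k
  free⇒onLastDummy-step {a} {k} free notFirst k+1<nA with dummy-taken a k+1<nA
  ... | inj₁ last = last
  ... | inj₂ (c′ , j , c′≡k+1 , j<k+1 , s′) =
    ⊥-elim (unblocked aₖ (inj₂ (a , j)) (edge , inj₁ aₖ-unmatched , inj₂ ((a , c′) , s′ , c<c′)))
    where
    c : Fin nA
    c = fromℕ< (<-trans (n<1+n k) k+1<nA)

    c≡k : toℕ c ≡ k
    c≡k = toℕ-fromℕ< _

    aₖ : A*
    aₖ = a , c

    edge : E* aₖ (inj₂ (a , j))
    edge = refl , inj₁ (trans c≡k (sym (suc-injective j<k+1)))

    c<c′ : toℕ c < toℕ c′
    c<c′ = subst₂ _<_ (sym c≡k) (sym c′≡k+1) (n<1+n k)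

    aₖ-unmatched : Unmatched aₖ
    aₖ-unmatched = copy-unmatched free notLast (λ j<c → notFirst c≡k (trans j<c c≡k))
      where
      notLast : ∀ {j′} → toℕ j′ ≡ toℕ c → S aₖ (inj₂ (a , j′)) ≢ true
      notLast j′≡c s with dummy-partner-unique (trans j′≡c (trans c≡k (sym (suc-injective j<k+1)))) s s′
      ... | refl = 1+n≢n (trans (sym c′≡k+1) c≡k)

  free⇒onLastDummy : ∀ {a} → Free a → ∀ k → suc k < nA → OnLastDummy a k
  free⇒onLastDummy free zero    = free⇒onLastDummy-step free (λ _ ())
  free⇒onLastDummy free (suc k) k+2<nA =
    free⇒onLastDummy-step free (lastDummy⇒next-notFirst (free⇒onLastDummy free k (<-trans (n<1+n _) k+2<nA))) k+2<nA

  top : Fin nA → Fin nA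
  top a = fromℕ< (K<nA a)

  free⇒top-unmatched : ∀ {a} → Free a → Unmatched (a , top a)
  free⇒top-unmatched {a} free = copy-unmatched free notLast notFirst
    where
    top≡K : toℕ (top a) ≡ K
    top≡K = toℕ-fromℕ< _

    notLast : ∀ {j} → toℕ j ≡ toℕ (top a) → S (a , top a) (inj₂ (a , j)) ≢ true
    notLast {j} j≡top _ = <-irrefl (trans j≡top top≡K) (toℕ<n j)

    notFirst : ∀ {j} → suc (toℕ j) ≡ toℕ (top a) → S (a , top a) (inj₂ (a , j)) ≢ true
    notFirst {j} j<top = lastDummy⇒next-notFirst
      (free⇒onLastDummy free (toℕ j) (subst (_< nA) (sym (trans j<top top≡K)) (K<nA a))) (sym j<top) refl

  realPartner? : ∀ a → Dec (∃ λ (cb : Fin nA × Fin nB) → S (a , proj₁ cb) (inj₁ (proj₂ cb)) ≡ true)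
  realPartner? a = ×-exhaustible any? any? (λ (c , b) → S (a , c) (inj₁ b) ≟ᵇ true)

  ℓA : Fin nA → ℕ
  ℓA a with realPartner? a
  ... | yes ((c , _) , _) = toℕ c
  ... | no _              = K

  ℓA-real : ∀ {a c b} → S (a , c) (inj₁ b) ≡ true → ℓA a ≡ toℕ c
  ℓA-real {a} s with realPartner? a
  ... | yes (_ , s′) = cong toℕ (real-copy-unique s′ s)
  ... | no none      = contradiction (_ , s) none

  ℓA-free : ∀ {a} → Free a → ℓA a ≡ K
  ℓA-free {a} free with realPartner? a
  ... | yes (_ , s) = contradiction s (free _ _)
  ... | no _        = refl

  ℓA≤K : ∀ a → ℓA a ≤ K
  ℓA≤K a with realPartner? a
  ... | yes ((c , _) , _) = toℕ≤K c
  ... | no _              = ≤-refl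

  partner? : ∀ b → Dec (∃ λ x → S x (inj₁ b) ≡ true)
  partner? b = ×-exhaustible any? any? (λ x → S x (inj₁ b) ≟ᵇ true)

  ℓB : Fin nB → ℕ
  ℓB b with partner? b
  ... | yes ((_ , c) , _) = toℕ c
  ... | no _              = 0

  ℓB-partner : ∀ {a c b} → S (a , c) (inj₁ b) ≡ true → ℓB b ≡ toℕ c
  ℓB-partner {b = b} s with partner? b
  ... | yes (_ , s′) = cong (toℕ ∘ proj₂) (uniqB _ _ _ s′ s)
  ... | no none      = contradiction (_ , s) none

  ℓB-free : ∀ {b} → (∀ x → S x (inj₁ b) ≢ true) → ℓB b ≡ 0
  ℓB-free {b} free with partner? b
  ... | yes (_ , s) = contradiction s (free _)
  ... | no _        = refl

  ℓB≤K : ∀ b → ℓB b ≤ K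
  ℓB≤K b with partner? b
  ... | yes ((_ , c) , _) = toℕ≤K c
  ... | no _              = z≤n

  belowLevel-onLastDummy : ∀ {a k} → ℓA a ≡ suc k → OnLastDummy a k
  belowLevel-onLastDummy {a} {k} ℓ≡k+1 with realPartner? a
  ... | yes ((c , b) , s) with dummy-taken a (subst (_< nA) ℓ≡k+1 (toℕ<n c))
  ...   | inj₁ last  = last
  ...   | inj₂ first = ⊥-elim (firstDummy-real-exclusive first (c , b , ℓ≡k+1 , s))
  belowLevel-onLastDummy {a} {k} ℓ≡k+1 | no none =
    free⇒onLastDummy (λ c b s → none ((c , b) , s)) k (subst (_< nA) ℓ≡k+1 (K<nA a))

  OutbidAt : Fin nA → Fin nB → ℕ → Set
  OutbidAt a b k = ∃ λ (x : A*) → S x (inj₁ b) ≡ true × k ≤ toℕ (proj₂ x) ×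
                                  (k ≡ toℕ (proj₂ x) → rankB b (proj₁ x) < rankB b a)

  wants⇒outbid : ∀ {a c b} → E a b ≡ true → S (a , c) (inj₁ b) ≢ true → WantsA S (a , c) (inj₁ b) →
                 OutbidAt a b (toℕ c)
  wants⇒outbid {a} {c} {b} ab∈E ¬s a-wants with partner? b
  ... | no free = ⊥-elim (unblocked (a , c) (inj₁ b) (ab∈E , a-wants , inj₁ λ x s → free (x , s)))
  ... | yes ((a′ , c′) , s′) = (a′ , c′) , s′ , ≮⇒≥ (¬b-wants ∘ inj₁) , tie
    where
    ¬b-wants : ¬ prefB* (inj₁ b) (a , c) (a′ , c′)
    ¬b-wants p = unblocked (a , c) (inj₁ b) (ab∈E , a-wants , inj₂ ((a′ , c′) , s′ , p))

    tie : toℕ c ≡ toℕ c′ → rankB b a′ < rankB b a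
    tie c≡c′ = ≤∧≢⇒< (≮⇒≥ (¬b-wants ∘ inj₂ ∘ (c≡c′ ,_))) distinct
      where
      distinct : rankB b a′ ≢ rankB b a
      distinct r with strictB b a′ a (⊆E* _ _ s′) ab∈E r
      ... | refl with toℕ-injective c≡c′
      ...   | refl = ¬s s′

  lastDummy⇒outbid : ∀ {a b k} → E a b ≡ true → OnLastDummy a k → OutbidAt a b k
  lastDummy⇒outbid {a} {b} ab∈E (c , j , c≡k , j≡k , s) =
    subst (OutbidAt a b) c≡k (wants⇒outbid ab∈E ¬real (prefers⇒wants (a , c) (inj₁ b) better))
    where
    ¬real : S (a , c) (inj₁ b) ≢ true
    ¬real s′ with uniqA _ _ _ s′ s
    ... | ()

    better : ∀ y′ → S (a , c) y′ ≡ true → prefA* (a , c) (inj₁ b) y′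
    better y′ s′ with uniqA _ _ _ s s′
    ... | refl = prefers-real-to-lastDummy {a′ = a} (trans j≡k (sym c≡k))

  preferred⇒outbid : ∀ {a c b b₀} → S (a , c) (inj₁ b₀) ≡ true → rankA a b < rankA a b₀ → E a b ≡ true →
                     OutbidAt a b (toℕ c)
  preferred⇒outbid {a} {c} {b} s₀ b≻b₀ ab∈E = wants⇒outbid ab∈E ¬s (prefers⇒wants (a , c) (inj₁ b) better)
    where
    ¬s : S (a , c) (inj₁ b) ≢ true
    ¬s s with uniqA _ _ _ s s₀
    ... | refl = <-irrefl refl b≻b₀

    better : ∀ y′ → S (a , c) y′ ≡ true → prefA* (a , c) (inj₁ b) y′
    better y′ s′ with uniqA _ _ _ s₀ s′
    ... | refl = inj₂ (refl , b≻b₀)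

  free⇒outbid : ∀ {a b} → Free a → E a b ≡ true → OutbidAt a b K
  free⇒outbid {a} free ab∈E = subst (OutbidAt a _) (toℕ-fromℕ< (K<nA a))
    (wants⇒outbid ab∈E (free⇒top-unmatched free _) (inj₁ (free⇒top-unmatched free)))

  S′ : Match G
  S′ = proj S

  S′-edge⁺ : ∀ {a c b} → S (a , c) (inj₁ b) ≡ true → S′ a b ≡ true
  S′-edge⁺ {a} {c} {b} = any-allFin⁺ (λ i → S (a , i) (inj₁ b)) c

  S′-edge⁻ : ∀ {a b} → S′ a b ≡ true → ∃[ c ] S (a , c) (inj₁ b) ≡ true
  S′-edge⁻ {a} {b} = any-allFin⁻ (λ i → S (a , i) (inj₁ b))

  S′-nonedge : ∀ {a b} → S′ a b ≡ false → ∀ c → S (a , c) (inj₁ b) ≢ true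
  S′-nonedge {a} {b} e c s = not-¬ s (any-allFin-false⁻ (λ i → S (a , i) (inj₁ b)) e c)

  S′-isMatching : IsMatching G S′
  S′-isMatching = record
    { ⊆E    = λ a b e → ⊆E* _ _ (proj₂ (S′-edge⁻ e))
    ; uniqA = λ a b b′ e e′ → one-real-partner (proj₂ (S′-edge⁻ e)) (proj₂ (S′-edge⁻ e′))
    ; uniqB = λ a a′ b e e′ → cong proj₁ (uniqB _ _ _ (proj₂ (S′-edge⁻ e)) (proj₂ (S′-edge⁻ e′)))
    }
    where
    one-real-partner : ∀ {a c c′ b b′} → S (a , c) (inj₁ b) ≡ true → S (a , c′) (inj₁ b′) ≡ true → b ≡ b′
    one-real-partner s s′ with real-copy-unique s s′
    ... | refl with uniqA _ _ _ s s′
    ...   | refl = refl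

  levels-agree : ∀ {a b} → S′ a b ≡ true → ℓA a ≡ ℓB b
  levels-agree e = let (_ , s) = S′-edge⁻ e in trans (ℓA-real s) (sym (ℓB-partner s))

  S′-freeA : ∀ {a} → matchedA G S′ a ≡ false → Free a
  S′-freeA {a} e c b = S′-nonedge (any-allFin-false⁻ (S′ a) e b) c

  S′-freeB : ∀ {b} → matchedB G S′ b ≡ false → ∀ x → S x (inj₁ b) ≢ true
  S′-freeB {b} e (a , c) = S′-nonedge (any-allFin-false⁻ (λ a → S′ a b) e a) c

  -- Popularity against a matching N of the same size

  module _ {N : Match G} (N-matching : IsMatching G N) where

    A-prefers-N A-prefers-S′ : Fin nA → Bool
    A-prefers-N = prefersA G N S′
    A-prefers-S′ = prefersA G S′ N

    B-prefers-N B-prefers-S′ : Fin nB → Bool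
    B-prefers-N = prefersB G N S′
    B-prefers-S′ = prefersB G S′ N

    N⊆E : ∀ {a b} → N a b ≡ true → E a b ≡ true
    N⊆E = IsMatching.⊆E N-matching _ _

    rowPrefs : ∀ {a b b₀} → N a b ≡ true → S′ a b₀ ≡ true →
               A-prefers-N a ≡ (rankA a b <ᵇ rankA a b₀) × A-prefers-S′ a ≡ (rankA a b₀ <ᵇ rankA a b)
    rowPrefs {a} nab ab₀ =
      prefers-matched (N a) (S′ a) (rankA a) oneN oneS′ nab ab₀ ,
      prefers-matched (S′ a) (N a) (rankA a) oneS′ oneN ab₀ nab
      where
      oneN = IsMatching.uniqA N-matching a
      oneS′ = IsMatching.uniqA S′-isMatching a

    columnPrefs : ∀ {a a₀ b} → N a b ≡ true → S′ a₀ b ≡ true →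
                  B-prefers-N b ≡ (rankB b a <ᵇ rankB b a₀) × B-prefers-S′ b ≡ (rankB b a₀ <ᵇ rankB b a)
    columnPrefs {b = b} nab a₀b =
      prefers-matched (λ a → N a b) (λ a → S′ a b) (rankB b) oneN oneS′ nab a₀b ,
      prefers-matched (λ a → S′ a b) (λ a → N a b) (rankB b) oneS′ oneN a₀b nab
      where
      oneN = λ a a′ → IsMatching.uniqB N-matching a a′ b
      oneS′ = λ a a′ → IsMatching.uniqB S′-isMatching a a′ b

    outbid-cases : ∀ {a b k} → N a b ≡ true → OutbidAt a b k →
                   k < ℓB b ⊎ (k ≡ ℓB b × B-prefers-N b ≡ false × B-prefers-S′ b ≡ true)
    outbid-cases nab ((a′ , c′) , s′ , k≤c′ , tie) rewrite ℓB-partner s′ with m≤n⇒m<n∨m≡n k≤c′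
    ... | inj₁ k<c′ = inj₁ k<c′
    ... | inj₂ k≡c′ =
      let (pb , qb) = columnPrefs nab (S′-edge⁺ s′)
      in  inj₂ (k≡c′ , trans pb (<ᵇ-false (<⇒≤ (tie k≡c′))) , trans qb (<ᵇ-true (tie k≡c′)))

    Balanced : Fin nA → Fin nB → Set
    Balanced a b = ind (A-prefers-N a) + ind (B-prefers-N b) + 2 * ℓA a ≤ ind (A-prefers-S′ a) + ind (B-prefers-S′ b) + 2 * ℓB b

    balanced-onS′ : ∀ {a b} → N a b ≡ true → S′ a b ≡ true → Balanced a b
    balanced-onS′ {a} {b} nab ab∈S′
      rewrite proj₁ (rowPrefs nab ab∈S′) | <ᵇ-false (≤-refl {rankA a b})
            | proj₁ (columnPrefs nab ab∈S′) | <ᵇ-false (≤-refl {rankB b a})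
            | levels-agree ab∈S′ = m≤n+m (2 * ℓB b) (ind (A-prefers-S′ a) + ind (B-prefers-S′ b))

    balanced-free : ∀ {a b} → N a b ≡ true → Free a → Balanced a b
    balanced-free {a} {b} nab free with outbid-cases nab (free⇒outbid free (N⊆E nab))
    ... | inj₁ K<ℓB = contradiction (ℓB≤K b) (<⇒≱ K<ℓB)
    ... | inj₂ (K≡ℓB , pb , qb) rewrite pb | qb | ℓA-free free | sym K≡ℓB =
      balance-free (ind (A-prefers-S′ a)) (2 * K) (ind≤1 (A-prefers-N a))

    balanced-upgrade : ∀ {a b b₀} → N a b ≡ true → S′ a b₀ ≡ true → rankA a b < rankA a b₀ → Balanced a b
    balanced-upgrade {a} {b} nab ab₀ b≻b₀ with S′-edge⁻ ab₀
    ... | c , s rewrite proj₁ (rowPrefs nab ab₀) | proj₂ (rowPrefs nab ab₀)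
                      | <ᵇ-true b≻b₀ | <ᵇ-false (<⇒≤ b≻b₀) | ℓA-real s
      with outbid-cases nab (preferred⇒outbid s b≻b₀ (N⊆E nab))
    ...   | inj₁ c<ℓB = balance-upgrade (ind (B-prefers-S′ b)) (ind≤1 (B-prefers-N b)) c<ℓB
    ...   | inj₂ (c≡ℓB , pb , qb) rewrite pb | qb | sym c≡ℓB = ≤-refl

    balanced-downgrade : ∀ {a b b₀} → N a b ≡ true → S′ a b₀ ≡ true → rankA a b₀ < rankA a b → Balanced a b
    balanced-downgrade {a} {b} nab ab₀ b₀≻b
      rewrite proj₁ (rowPrefs nab ab₀) | proj₂ (rowPrefs nab ab₀) | <ᵇ-false (<⇒≤ b₀≻b) | <ᵇ-true b₀≻b
      with ℓA a in ℓ≡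
    ... | zero  = balance-downgrade (ind (B-prefers-S′ b)) (ind≤1 (B-prefers-N b)) (z≤n {ℓB b})
    ... | suc k with outbid-cases nab (lastDummy⇒outbid (N⊆E nab) (belowLevel-onLastDummy ℓ≡))
    ...   | inj₁ k<ℓB = balance-downgrade (ind (B-prefers-S′ b)) (ind≤1 (B-prefers-N b)) k<ℓB
    ...   | inj₂ (k≡ℓB , pb , qb) rewrite pb | qb | sym k≡ℓB = ≤-reflexive (*-suc 2 k)

    edge-balance : ∀ {a b} → N a b ≡ true → Balanced a b
    edge-balance {a} {b} nab with matchedA G S′ a ≟ᵇ true
    ... | no a-free = balanced-free nab (S′-freeA (¬-not a-free))
    ... | yes a-matched with any-allFin⁻ (S′ a) a-matched
    ...   | b₀ , ab₀ with <-cmp (rankA a b) (rankA a b₀)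
    ...     | tri< b≻b₀ _ _ = balanced-upgrade nab ab₀ b≻b₀
    ...     | tri> _ _ b₀≻b = balanced-downgrade nab ab₀ b₀≻b
    ...     | tri≈ _ same _ with strictA a b b₀ (N⊆E nab) (IsMatching.⊆E S′-isMatching a b₀ ab₀) same
    ...       | refl = balanced-onS′ nab ab₀

    levelSum-≤ : size G N ≡ size G S′ → edgeSum G N (λ _ b → ℓB b) ≤ edgeSum G N (λ a _ → ℓA a)
    levelSum-≤ |N|≡|S′| = begin
      edgeSum G N (λ _ b → ℓB b)                               ≡⟨ edgeSum-columns G N N-matching ℓB ⟩
      ∑[ b < nB ] (if matchedB G N b then ℓB b else 0)         ≤⟨ ∑-restrict-≤ (matchedB G N) ℓB ⟩
      ∑[ b < nB ] ℓB b                                         ≡⟨ sym (∑-restrict (matchedB G S′) ℓB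
                                                                    λ b free → ℓB-free (S′-freeB free)) ⟩
      ∑[ b < nB ] (if matchedB G S′ b then ℓB b else 0)        ≡⟨ sym (edgeSum-columns G S′ S′-isMatching ℓB) ⟩
      edgeSum G S′ (λ _ b → ℓB b)                              ≡⟨ edgeSum-cong G S′ (λ _ _ e → sym (levels-agree e)) ⟩
      edgeSum G S′ (λ a _ → ℓA a)                              ≤⟨ rowSum-≤ G S′-isMatching N-matching (sym |N|≡|S′|)
                                                                    ℓA K ℓA≤K (λ a free → ℓA-free (S′-freeA free)) ⟩
      edgeSum G N (λ a _ → ℓA a)                               ∎
      where open ≤-Reasoning

    popular : size G N ≡ size G S′ → φ G N S′ ≤ φ G S′ N
    popular |N|≡|S′| = begin
      φ G N S′                                ≡⟨ cong₂ _+_ (count-prefersA G N N-matching S′) (count-prefersB G N N-matching S′) ⟩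
      edgeSum G N (λ a _ → ind (A-prefers-N a)) +
      edgeSum G N (λ _ b → ind (B-prefers-N b))        ≡⟨ sym (edgeSum-+ G N _ _) ⟩
      edgeSum G N votesN                         ≤⟨ +-cancelʳ-≤ (2 * levelsA) _ _ (≤-trans summed-balance
                                                   (+-monoʳ-≤ (edgeSum G N votesS′) (*-monoʳ-≤ 2 (levelSum-≤ |N|≡|S′|)))) ⟩
      edgeSum G N votesS′                        ≡⟨ edgeSum-+ G N _ _ ⟩
      edgeSum G N (λ a _ → ind (A-prefers-S′ a)) +
      edgeSum G N (λ _ b → ind (B-prefers-S′ b))        ≤⟨ +-mono-≤ (edgeSum≤countA G N N-matching A-prefers-S′) (edgeSum≤countB G N N-matching B-prefers-S′) ⟩
      φ G S′ N                                ∎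
      where
      open ≤-Reasoning
      votesN votesS′ : Fin nA → Fin nB → ℕ
      votesN  a b = ind (A-prefers-N a) + ind (B-prefers-N b)
      votesS′ a b = ind (A-prefers-S′ a) + ind (B-prefers-S′ b)

      levelsA levelsB : ℕ
      levelsA = edgeSum G N (λ a _ → ℓA a)
      levelsB = edgeSum G N (λ _ b → ℓB b)

      summed-balance : edgeSum G N votesN + 2 * levelsA ≤ edgeSum G N votesS′ + 2 * levelsB
      summed-balance = begin
        edgeSum G N votesN + 2 * levelsA                   ≡⟨ cong (edgeSum G N votesN +_) (sym (edgeSum-* G N 2 _)) ⟩
        edgeSum G N votesN + edgeSum G N (λ a _ → 2 * ℓA a)  ≡⟨ sym (edgeSum-+ G N _ _) ⟩
        edgeSum G N (λ a b → votesN a b + 2 * ℓA a)          ≤⟨ edgeSum-mono G N (λ _ _ → edge-balance) ⟩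
        edgeSum G N (λ a b → votesS′ a b + 2 * ℓB b)         ≡⟨ edgeSum-+ G N _ _ ⟩
        edgeSum G N votesS′ + edgeSum G N (λ _ b → 2 * ℓB b) ≡⟨ cong (edgeSum G N votesS′ +_) (edgeSum-* G N 2 _) ⟩
        edgeSum G N votesS′ + 2 * levelsB                  ∎

  -- Maximality: a vertex cover of size |S′| cut at an unoccupied level

  module _ (k : ℕ) (unoccupied : ∀ a → matchedA G S′ a ≡ true → ℓA a ≢ k)
           (k≤K : ∀ a → matchedA G S′ a ≡ false → k ≤ K) where

    coverA : Fin nA → ℕ
    coverA a = ind (matchedA G S′ a ∧ (ℓA a <ᵇ k))

    coverB : Fin nB → ℕ
    coverB b = ind (matchedB G S′ b ∧ not (ℓB b <ᵇ k))

    outbid⇒coverB : ∀ {a b k′} → OutbidAt a b k′ → k ≤ k′ → coverB b ≡ 1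
    outbid⇒coverB {b = b} ((a′ , c′) , s′ , k′≤c′ , _) k≤k′
      rewrite any-allFin⁺ (λ a → S′ a b) a′ (S′-edge⁺ s′) | ℓB-partner s′ | <ᵇ-false (≤-trans k≤k′ k′≤c′) = refl

    covered : ∀ a b → E a b ≡ true → 1 ≤ coverA a + coverB b
    covered a b ab∈E with matchedA G S′ a ≟ᵇ true
    ... | no a-free rewrite outbid⇒coverB (free⇒outbid (S′-freeA (¬-not a-free)) ab∈E) (k≤K a (¬-not a-free)) =
      m≤n+m 1 (coverA a)
    ... | yes a-matched with <-cmp (ℓA a) k
    ...   | tri< ℓ<k _ _ rewrite a-matched | <ᵇ-true ℓ<k = s≤s z≤n
    ...   | tri≈ _ ℓ≡k _ = contradiction ℓ≡k (unoccupied a a-matched)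
    ...   | tri> _ _ k<ℓ = covered-above (ℓA a) refl k<ℓ
      where
      covered-above : ∀ ℓ → ℓA a ≡ ℓ → k < ℓ → 1 ≤ coverA a + coverB b
      covered-above (suc k′) ℓ≡ (s≤s k≤k′)
        rewrite outbid⇒coverB (lastDummy⇒outbid ab∈E (belowLevel-onLastDummy ℓ≡)) k≤k′ = m≤n+m 1 (coverA a)

    S′-cover-tight : ∀ a b → S′ a b ≡ true → coverA a + coverB b ≡ 1
    S′-cover-tight a b ab∈S′
      rewrite any-allFin⁺ (S′ a) b ab∈S′ | any-allFin⁺ (λ a → S′ a b) a ab∈S′ | levels-agree ab∈S′
      with ℓB b <ᵇ k
    ... | true  = refl
    ... | false = refl

    S′-maximum-by-cover : ∀ N → IsMatching G N → size G N ≤ size G S′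
    S′-maximum-by-cover N N-matching =
      subst (size G N ≤_)
        (sym (size≡cover G S′ S′-isMatching coverA coverB S′-cover-tight
                (λ a free → cong (λ m → ind (m ∧ (ℓA a <ᵇ k))) free)
                (λ b free → cong (λ m → ind (m ∧ not (ℓB b <ᵇ k))) free)))
        (size≤cover G N N-matching coverA coverB (λ a b nab → covered a b (IsMatching.⊆E N-matching a b nab)))

  unoccupied-level : ∃ λ k → (∀ a → matchedA G S′ a ≡ true → ℓA a ≢ k) × (∀ a → matchedA G S′ a ≡ false → k ≤ K)
  unoccupied-level with any? (λ a → matchedA G S′ a ≟ᵇ false)
  ... | no allMatched =
    nA , (λ a _ ℓ≡nA → <-irrefl ℓ≡nA (≤-<-trans (ℓA≤K a) (K<nA a))) , λ a free → contradiction (a , free) allMatched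
  ... | yes (a₀ , a₀-free) =
    let (k , missed) = missed-value (λ a → matchedA G S′ a ≟ᵇ true) ℓA a₀ (λ m → not-¬ m a₀-free)
    in  toℕ k , missed , λ _ _ → toℕ≤K k

  S′-maximum : ∀ N → IsMatching G N → size G N ≤ size G S′
  S′-maximum = let (k , unoccupied , k≤K) = unoccupied-level in S′-maximum-by-cover k unoccupied k≤K

theorem3 : (G : Instance) (S : Star.Match* G) →
           Star.IsStable G S → IsPopularMaxMatching G (Star.proj G S)
theorem3 G S stable = (S′-isMatching , S′-maximum) , S′-popular
  where
  open StableMatching G S stable

  S′-popular : ∀ N → IsMaximum G N → ℤ.+ 0 ℤ.≤ Δ G S′ N
  S′-popular N (N-matching , N-maximum) =
    i≤j⇒0≤j-i (ℤ.+≤+ (popular N-matching (≤-antisym (S′-maximum N N-matching) (N-maximum S′ S′-isMatching))))
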